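{- Let $m$ be a positive integer with $m\in\operatorname{Im}(P)$. Then $f(m)$ equals the total number, over all pairs of non-negative integers $(a,b)$ with $a\equiv b\pmod 2$ and $m=b^2+2a$, of non-negative integer solutions $(x_1,\ldots,x_b)=(c_1,\ldots,c_b)$ with $c_1\ge c_2\ge\cdots\ge c_b\ge 0$ of the system $$b=x_1+\cdots+x_b,\qquad a=x_1^2+\cdots+x_b^2.$$
   Context: $\mathcal{M}$ is the set of all two-line matrices $M=\begin{pmatrix} c_1 & \cdots & c_s\\ d_1 & \cdots & d_s\end{pmatrix}$ ($s\ge1$) with non-negative integer entries satisfying $c_s=0$, $d_s\ne0$, and $c_j=c_{j+1}+d_{j+1}$ for $1\le j\le s-1$; $\mathcal{M}_0$ is the subset of those with $d_1=0$. With $\ell(M)$ the sum of all entries and $N=\ell(M)-d_1$, $P(M)$ is the sum of the numbers $2\big(N-(d_2+\cdots+d_k)-(c_1+\cdots+c_{k-1})-i\big)-1$ over $k=1,\ldots,s-1$ and $i=0,\ldots,c_k-1$; $\operatorname{Im}(P)$ is the image of $P$ on $\mathcal{M}$. The frequency $f(m)$ is the number of $M\in\mathcal{M}_0$ with $P(M)=m$. -}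

module Defs where

open import Data.Nat using (ℕ; zero; suc; _+_; _*_; _∸_; _^_; _<_; _≥_; NonZero)
open import Data.Nat.DivMod using (_%_)
open import Data.Fin using (Fin; toℕ; inject₁)
open import Data.Vec using (Vec; lookup; head; tail; init; last; toList; zipWith)
open import Data.List using (List; map; upTo; take; allFin)
open import Data.Nat.ListAction using (sum)
open import Data.List.Relation.Unary.Linked using (Linked)
open import Data.Product using (Σ; _×_; ∃)
open import Relation.Binary.PropositionalEquality using (_≡_)

-- A two-line matrix M = (c_1 … c_s ; d_1 … d_s) with s = suc t ≥ 1,
-- c_s = 0, d_s ≠ 0 and c_j = c_{j+1} + d_{j+1} for 1 ≤ j ≤ s-1.
-- (All proof fields are proof-irrelevant, so equality of matrices is
-- equality of the underlying data.)
record Matrix : Set where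
  constructor mkMatrix
  field
    t      : ℕ                     -- s = suc t columns
    c      : Vec ℕ (suc t)
    d      : Vec ℕ (suc t)
    cLast  : last c ≡ 0
    dLast  : NonZero (last d)
    chain  : init c ≡ zipWith _+_ (tail c) (tail d)
                                   -- c_j = c_{j+1} + d_{j+1}, 1 ≤ j ≤ s-1

open Matrix public

In𝓜₀ : Matrix → Set
In𝓜₀ M = head (d M) ≡ 0

ℓ : Matrix → ℕ
ℓ M = sum (toList (c M)) + sum (toList (d M))

Nval : Matrix → ℕ
Nval M = ℓ M ∸ head (d M)

-- P(M) = Σ_{k=1}^{s-1} Σ_{i=0}^{c_k - 1}
--          2 (N - (d_2+…+d_k) - (c_1+…+c_{k-1}) - i) - 1.
-- Here k is 0-indexed (k : Fin t stands for column k+1), so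
-- d_2+…+d_{k+1} = sum of the first k entries of tail d, and
-- c_1+…+c_k = sum of the first k entries of c.
-- (The inner quantity is always ≥ 1 for matrices in 𝓜, so truncated
-- subtraction agrees with integer subtraction.)
P : Matrix → ℕ
P M = sum (map term (allFin (t M)))
  where
  term : Fin (t M) → ℕ
  term k = sum (map (λ i → 2 * (Nval M ∸ sum (take (toℕ k) (toList (tail (d M))))
                                        ∸ sum (take (toℕ k) (toList (c M)))
                                        ∸ i) ∸ 1)
                    (upTo (lookup (c M) (inject₁ k))))

InImP : ℕ → Set
InImP m = ∃ λ (M : Matrix) → P M ≡ m

-- The set whose cardinality is f(m): M ∈ 𝓜₀ with P(M) = m
Fiber : ℕ → Set
Fiber m = Σ Matrix λ M → In𝓜₀ M × P M ≡ m

NonIncreasing : ∀ {b} → Vec ℕ b → Set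
NonIncreasing x = Linked _≥_ (toList x)

Solutions : ℕ → ℕ → Set
Solutions a b = Σ (Vec ℕ b) λ x →
  NonIncreasing x × sum (toList x) ≡ b × sum (map (λ y → y ^ 2) (toList x)) ≡ a

-- Disjoint union over pairs (a,b) with a ≡ b (mod 2) and m = b² + 2a
-- of the solution sets; its cardinality is the right-hand side.
RHS : ℕ → Set
RHS m = Σ ℕ λ a → Σ ℕ λ b →
  (a % 2 ≡ b % 2) × (m ≡ b ^ 2 + 2 * a) × Solutions a b

module Submission where

-- Write a matrix M ∈ 𝓜₀ through its top row: since
-- c_j = c_{j+1} + d_{j+1}, c_s = 0 and d_s > 0, the list
-- L = (c_1, …, c_{s-1}) is a non-increasing list of positive integers
-- (a "profile"), and M is recovered from L (d_1 = 0, d_{j+1} = c_j − c_{j+1}).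
-- Evaluating the double sum defining P column by column, the k-th inner
-- sum is a run of c_k consecutive odd numbers, equal to c_k² + 2 c_k S_k
-- with S_k = c_k + … + c_s; adding up gives
--         P(M) = (Σ L)² + 2 Σ L².
-- Hence the fibre of P over m is in bijection with the profiles L satisfying
-- m = b² + 2a for b = Σ L, a = Σ L² (m > 0 excludes the empty profile, which
-- would be the forbidden matrix with s = 1, d_1 = 0).  Finally a profile of
-- sum b has at most b entries, so padding it with zeros to length b (and
-- conversely stripping trailing zeros) identifies profiles with the
-- non-increasing solutions of the system; the parity condition a ≡ b (mod 2)
-- holds automatically since x² ≡ x (mod 2).

open import Defs
open import Data.Nat using (ℕ; _<_)
open import Function.Bundles using (_↔_)

open import Data.Nat using (zero; suc; _+_; _*_; _∸_; _^_; _≤_; _≥_; z≤n; s≤s; NonZero; _≟_; >-nonZero⁻¹; >-nonZero)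
open import Data.Nat.Properties
open import Data.Nat.DivMod using (_%_; [m+kn]%n≡m%n; %-distribˡ-+)
open import Data.Nat.Tactic.RingSolver using (solve-∀)
open import Data.Nat.ListAction using (sum)
open import Data.Nat.ListAction.Properties using (sum-++)
open import Data.Fin using (Fin; toℕ; inject₁) renaming (zero to fzero; suc to fsuc)
open import Data.Vec using (Vec; []; _∷_; toList; lookup; init; last; tail; zipWith; initLast)
open import Data.Vec.Properties using (length-toList; ∷-injective; ≡-dec; toList-injective; toList-∷ʳ)
open import Data.Vec.Relation.Binary.Equality.Cast using (cast-is-id)
open import Data.List using (List; []; _∷_; map; upTo; take; allFin; applyUpTo; tabulate; length; _++_)
open import Data.List.Properties using (map-tabulate; map-id; map-++)
open import Data.List.Relation.Unary.Linked as Linked using (Linked; []; [-]; _∷_)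
open import Data.List.Relation.Unary.All as All using (All; []; _∷_)
open import Data.Product using (_×_; _,_; proj₂; Σ)
open import Data.Empty using (⊥-elim)
open import Axiom.UniquenessOfIdentityProofs using (module Decidable⇒UIP)
open import Relation.Binary.PropositionalEquality
open import Function.Bundles using (mk↔ₛ′)
open import Function.Properties.Inverse using (↔-trans)
open ≡-Reasoning

-- sumBelow f n = f 0 + … + f (n − 1); unfolding from the bottom makes the
-- index shift i ↦ i + 1 definitional.
sumBelow : (ℕ → ℕ) → ℕ → ℕ
sumBelow f zero    = 0
sumBelow f (suc n) = f 0 + sumBelow (λ i → f (suc i)) n

sumBelow-cong : ∀ {f g} n → (∀ i → f i ≡ g i) → sumBelow f n ≡ sumBelow g n
sumBelow-cong zero    f≗g = refl
sumBelow-cong (suc n) f≗g = cong₂ _+_ (f≗g 0) (sumBelow-cong n (λ i → f≗g (suc i)))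

sum-applyUpTo : ∀ (g f : ℕ → ℕ) n → sum (map g (applyUpTo f n)) ≡ sumBelow (λ i → g (f i)) n
sum-applyUpTo g f zero    = refl
sum-applyUpTo g f (suc n) = cong (g (f 0) +_) (sum-applyUpTo g (λ i → f (suc i)) n)

sum-tabulate : ∀ n (g : Fin n → ℕ) (F : ℕ → ℕ) → (∀ k → g k ≡ F (toℕ k)) →
               sum (tabulate g) ≡ sumBelow F n
sum-tabulate zero    g F g≗F = refl
sum-tabulate (suc n) g F g≗F =
  cong₂ _+_ (g≗F fzero) (sum-tabulate n (λ k → g (fsuc k)) (λ i → F (suc i)) (λ k → g≗F (fsuc k)))

sum-allFin : ∀ n (h : Fin n → ℕ) (F : ℕ → ℕ) → (∀ k → h k ≡ F (toℕ k)) →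
             sum (map h (allFin n)) ≡ sumBelow F n
sum-allFin n h F h≗F = trans (cong sum (map-tabulate (λ k → k) h)) (sum-tabulate n h F h≗F)

sum-∷ʳ0 : ∀ L → sum (L ++ 0 ∷ []) ≡ sum L
sum-∷ʳ0 L = trans (sum-++ L (0 ∷ [])) (+-identityʳ (sum L))

sum-as-map : ∀ L → sum L ≡ sum (map (λ y → y) L)
sum-as-map L = cong sum (sym (map-id L))

sq : ℕ → ℕ
sq y = y ^ 2

sumsq : List ℕ → ℕ
sumsq L = sum (map sq L)

sumsq-∷ʳ0 : ∀ L → sumsq (L ++ 0 ∷ []) ≡ sumsq L
sumsq-∷ʳ0 L = trans (cong sum (map-++ sq L (0 ∷ []))) (sum-∷ʳ0 (map sq L))

oddRun : ℕ → ℕ → ℕ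
oddRun Y c = sum (map (λ i → 2 * (Y ∸ i) ∸ 1) (upTo c))

oddRun-sum : ∀ c S → oddRun (c + S) c ≡ c * c + 2 * c * S
oddRun-sum c S = trans (sum-applyUpTo _ (λ i → i) c) (byInduction c)
  where
  -- The new first term 2(c + 1 + S) − 1 unfolds to (c + S) + suc ((c + S) + 0).
  next-odd : ∀ c S → (c + S) + suc ((c + S) + 0) + (c * c + 2 * c * S) ≡ suc c * suc c + 2 * suc c * S
  next-odd = solve-∀
  byInduction : ∀ c → sumBelow (λ i → 2 * ((c + S) ∸ i) ∸ 1) c ≡ c * c + 2 * c * S
  byInduction zero    = refl
  byInduction (suc c) = trans (cong ((c + S) + suc ((c + S) + 0) +_) (byInduction c)) (next-odd c S)

-- Staircase cs es: cs = (c_1, …, c_s) and es = (d_2, …, d_s) satisfy c_s = 0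
-- and c_j = c_{j+1} + d_{j+1}; this is the list form of a matrix's rows.
data Staircase : List ℕ → List ℕ → Set where
  bottom : Staircase (0 ∷ []) []
  step   : ∀ {y e cs es} → Staircase (y ∷ cs) es → Staircase (y + e ∷ y ∷ cs) (e ∷ es)

staircase : ∀ {t} (c : Vec ℕ (suc t)) (e : Vec ℕ t) → last c ≡ 0 →
            init c ≡ zipWith _+_ (tail c) e → Staircase (toList c) (toList e)
staircase {zero}  (x ∷ [])     []        refl _     = bottom
staircase {suc t} (x ∷ y ∷ cs) (e₀ ∷ es) cs≡0 chain with ∷-injective chain
... | refl , chain′ = step (staircase (y ∷ cs) es cs≡0 chain′)

staircase-sum : ∀ {y cs es} → Staircase (y ∷ cs) es → sum es ≡ y
staircase-sum bottom                 = refl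
staircase-sum (step {y} {e} stairs) = trans (cong (e +_) (staircase-sum stairs)) (+-comm e y)

-- k-th entry of a list (0 beyond its end).
entry : ℕ → List ℕ → ℕ
entry _       []       = 0
entry zero    (x ∷ _)  = x
entry (suc i) (_ ∷ xs) = entry i xs

lookup-inject₁ : ∀ {n} (v : Vec ℕ (suc n)) (k : Fin n) → lookup v (inject₁ k) ≡ entry (toℕ k) (toList v)
lookup-inject₁ (x ∷ v)     fzero    = refl
lookup-inject₁ (x ∷ y ∷ v) (fsuc k) = lookup-inject₁ (y ∷ v) k

column : ℕ → List ℕ → List ℕ → ℕ → ℕ
column X cs es k = oddRun (X ∸ sum (take k es) ∸ sum (take k cs)) (entry k cs)

-- Dropping the first column: the later columns see X diminished by d_2 + c_1.
∸-regroup : ∀ X e c A B → X ∸ (e + A) ∸ (c + B) ≡ X ∸ (e + c) ∸ A ∸ B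
∸-regroup X e c A B = begin
  X ∸ (e + A) ∸ (c + B)   ≡⟨ ∸-+-assoc X (e + A) (c + B) ⟩
  X ∸ ((e + A) + (c + B)) ≡⟨ cong (X ∸_) (regroup e c A B) ⟩
  X ∸ (((e + c) + A) + B) ≡⟨ sym (∸-+-assoc X ((e + c) + A) B) ⟩
  X ∸ ((e + c) + A) ∸ B   ≡⟨ cong (_∸ B) (sym (∸-+-assoc X (e + c) A)) ⟩
  X ∸ (e + c) ∸ A ∸ B     ∎
  where
  regroup : ∀ e c A B → (e + A) + (c + B) ≡ ((e + c) + A) + B
  regroup = solve-∀

-- Induction on the staircase: the first
-- column is oddRun (c_1 + Σ cs) c_1 and the rest is the same sum for the
-- shorter staircase with X − d_2 − c_1 = c_2 + Σ (c_2, …).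
columns-sum : ∀ {y cs es} → Staircase (y ∷ cs) es → ∀ X → X ≡ y + sum (y ∷ cs) →
              sumBelow (column X (y ∷ cs) es) (length es) ≡ sum (y ∷ cs) ^ 2 + 2 * sumsq (y ∷ cs)
columns-sum bottom X _ = refl
columns-sum (step {y} {e} {cs} {es} stairs) X X≡ = begin
  oddRun X (y + e) + sumBelow (λ i → column X (y + e ∷ y ∷ cs) (e ∷ es) (suc i)) (length es)
    ≡⟨ cong₂ _+_ (cong (λ Z → oddRun Z (y + e)) X≡) (sumBelow-cong (length es) shift) ⟩
  oddRun ((y + e) + S) (y + e) + sumBelow (column X′ (y ∷ cs) es) (length es)
    ≡⟨ cong₂ _+_ (oddRun-sum (y + e) S) (columns-sum stairs X′ X′≡) ⟩
  (y + e) * (y + e) + 2 * (y + e) * S + (sum (y ∷ cs) ^ 2 + 2 * sumsq (y ∷ cs))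
    ≡⟨ square-of-sum (y + e) (sum (y ∷ cs)) (sumsq (y ∷ cs)) ⟩
  S ^ 2 + 2 * sumsq (y + e ∷ y ∷ cs) ∎
  where
  S  = sum (y + e ∷ y ∷ cs)
  X′ = X ∸ (e + (y + e))
  shift : ∀ i → column X (y + e ∷ y ∷ cs) (e ∷ es) (suc i) ≡ column X′ (y ∷ cs) es i
  shift i = cong (λ Z → oddRun Z (entry i (y ∷ cs)))
                 (∸-regroup X e (y + e) (sum (take i es)) (sum (take i (y ∷ cs))))
  X′≡ : X′ ≡ y + sum (y ∷ cs)
  X′≡ = trans (cong (_∸ (e + (y + e))) (trans X≡ (regroup y e (sum cs))))
              (m+n∸m≡n (e + (y + e)) (y + (y + sum cs)))
    where
    regroup : ∀ y e s → (y + e) + ((y + e) + (y + s)) ≡ (e + (y + e)) + (y + (y + s))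
    regroup = solve-∀
  square-of-sum : ∀ c s q → c * c + 2 * c * (c + s) + ((s * (s * 1)) + 2 * q)
                  ≡ (c + s) * ((c + s) * 1) + 2 * (c * (c * 1) + q)
  square-of-sum = solve-∀

profile : Matrix → List ℕ
profile M = toList (init (c M))

toList-init-last : ∀ {n} (v : Vec ℕ (suc n)) → toList v ≡ toList (init v) ++ last v ∷ []
toList-init-last v = trans (cong toList (proj₂ (proj₂ (initLast v)))) (toList-∷ʳ (last v) (init v))

P-formula : ∀ (M : Matrix) → In𝓜₀ M → P M ≡ sum (profile M) ^ 2 + 2 * sumsq (profile M)
P-formula M@(mkMatrix t c@(c₁ ∷ _) (d₁ ∷ e) c-last _ chain) refl = begin
  P M
    ≡⟨ sum-allFin t _ (column N (toList c) (toList e)) (λ k → cong (oddRun _) (lookup-inject₁ c k)) ⟩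
  sumBelow (column N (toList c) (toList e)) t
    ≡⟨ cong (sumBelow _) (sym (length-toList e)) ⟩
  sumBelow (column N (toList c) (toList e)) (length (toList e))
    ≡⟨ columns-sum stairs N N≡ ⟩
  sum (toList c) ^ 2 + 2 * sumsq (toList c)
    ≡⟨ cong (λ z → sum z ^ 2 + 2 * sumsq z) (trans (toList-init-last c) (cong (λ w → L ++ w ∷ []) c-last)) ⟩
  sum (L ++ 0 ∷ []) ^ 2 + 2 * sumsq (L ++ 0 ∷ [])
    ≡⟨ cong₂ (λ a b → a ^ 2 + 2 * b) (sum-∷ʳ0 L) (sumsq-∷ʳ0 L) ⟩
  sum L ^ 2 + 2 * sumsq L ∎
  where
  N = sum (toList c) + sum (toList e)
  L = profile M
  stairs = staircase c e c-last chain
  -- N = c_1 + Σ c because d_2 + … + d_s = c_1.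
  N≡ : N ≡ c₁ + sum (toList c)
  N≡ = trans (cong (sum (toList c) +_) (staircase-sum stairs)) (+-comm (sum (toList c)) c₁)

Profile : List ℕ → Set
Profile L = Linked _≥_ L × All (0 <_) L

ProfileFiber : ℕ → Set
ProfileFiber m = Σ (List ℕ) λ L → Profile L × m ≡ sum L ^ 2 + 2 * sumsq L

profileFiber-≡ : ∀ {m L L′} (p : Profile L × m ≡ sum L ^ 2 + 2 * sumsq L)
                 (q : Profile L′ × m ≡ sum L′ ^ 2 + 2 * sumsq L′) →
                 L ≡ L′ → _≡_ {A = ProfileFiber m} (L , p) (L′ , q)
profileFiber-≡ ((lk , pos) , eq) ((lk′ , pos′) , eq′) refl
  with Linked.irrelevant ≤-irrelevant lk lk′ | All.irrelevant <-irrelevant pos pos′ | ≡-irrelevant eq eq′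
... | refl | refl | refl = refl

vec-≡ : ∀ {n} (xs ys : Vec ℕ n) → toList xs ≡ toList ys → xs ≡ ys
vec-≡ xs ys eq = trans (sym (cast-is-id refl xs)) (toList-injective refl xs ys eq)

nonZero-irrelevant : ∀ {n} (p q : NonZero n) → p ≡ q
nonZero-irrelevant {suc n} _ _ = refl

-- Two matrices with the same number of columns and the same rows are equal:
-- all remaining fields are propositions.
same-rows : ∀ {t t′} → t ≡ t′ → ∀ {c d c′ d′} cl dl ch cl′ dl′ ch′ →
            toList c ≡ toList c′ → toList d ≡ toList d′ →
            mkMatrix t c d cl dl ch ≡ mkMatrix t′ c′ d′ cl′ dl′ ch′
same-rows refl {c} {d} {c′} {d′} cl dl ch cl′ dl′ ch′ ec ed with vec-≡ c c′ ec | vec-≡ d d′ ed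
... | refl | refl
  with ≡-irrelevant cl cl′ | nonZero-irrelevant dl dl′ | Decidable⇒UIP.≡-irrelevant (≡-dec _≟_) ch ch′
... | refl | refl | refl = refl

matrix-≡ : ∀ (M M′ : Matrix) → toList (c M) ≡ toList (c M′) → toList (d M) ≡ toList (d M′) → M ≡ M′
matrix-≡ (mkMatrix t c d cl dl ch) (mkMatrix t′ c′ d′ cl′ dl′ ch′) ec ed =
  same-rows (suc-injective (trans (sym (length-toList c)) (trans (cong length ec) (length-toList c′))))
            cl dl ch cl′ dl′ ch′ ec ed

staircase-descends : ∀ {t} (c : Vec ℕ (suc (suc t))) (e : Vec ℕ (suc t)) → Staircase (toList c) (toList e) →
                     Linked _≥_ (toList (init c)) × All (last e ≤_) (toList (init c))
staircase-descends {zero}  (_ ∷ _ ∷ [])     (_ ∷ [])        (step bottom) = [-] , (≤-refl ∷ [])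
staircase-descends {suc t} (_ ∷ y ∷ z ∷ cs) (e₀ ∷ e₁ ∷ es) (step stairs)
  with staircase-descends (y ∷ z ∷ cs) (e₁ ∷ es) stairs
... | descends , (y≥dₛ ∷ rest≥dₛ) = (m≤m+n y e₀ ∷ descends) , (≤-trans y≥dₛ (m≤m+n y e₀) ∷ y≥dₛ ∷ rest≥dₛ)

-- Since d_s > 0, the profile of a matrix in 𝓜₀ is a profile.  (With s = 1
-- we would have d_1 = d_s, so s ≥ 2.)
profile-isProfile : ∀ M → In𝓜₀ M → Profile (profile M)
profile-isProfile (mkMatrix zero    c (d₁ ∷ []) _ () _) refl
profile-isProfile (mkMatrix (suc t) c (d₁ ∷ e) c-last dₛ≢0 chain) refl
  with staircase-descends c e (staircase c e c-last chain)
... | descends , ≥dₛ = descends , All.map (<-≤-trans (>-nonZero⁻¹ (last e) {{dₛ≢0}})) ≥dₛ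

toProfile : ∀ {m} → Fiber m → ProfileFiber m
toProfile (M , M∈𝓜₀ , PM≡m) = profile M , profile-isProfile M M∈𝓜₀ , trans (sym PM≡m) (P-formula M M∈𝓜₀)

topRow : (L : List ℕ) → Vec ℕ (suc (length L))
topRow []      = 0 ∷ []
topRow (x ∷ L) = x ∷ topRow L

gaps : (L : List ℕ) → Vec ℕ (length L)
gaps []          = []
gaps (x ∷ [])    = x ∷ []
gaps (x ∷ y ∷ L) = (x ∸ y) ∷ gaps (y ∷ L)

-- The matrix axioms for these rows; d_s = c_{s-1} > 0 needs positivity and
-- c_j = c_{j+1} + (c_j − c_{j+1}) needs monotonicity.
topRow-last : ∀ L → last (topRow L) ≡ 0
topRow-last []      = refl
topRow-last (x ∷ L) = topRow-last L

topRow-init : ∀ L → toList (init (topRow L)) ≡ L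
topRow-init []      = refl
topRow-init (x ∷ L) = cong (x ∷_) (topRow-init L)

topRow-toList : ∀ L → toList (topRow L) ≡ L ++ 0 ∷ []
topRow-toList []      = refl
topRow-toList (x ∷ L) = cong (x ∷_) (topRow-toList L)

gaps-last : ∀ x L → All (0 <_) (x ∷ L) → NonZero (last (gaps (x ∷ L)))
gaps-last x []      (x>0 ∷ _) = >-nonZero x>0
gaps-last x (y ∷ L) (_ ∷ pos) = gaps-last y L pos

topRow-chain : ∀ L → Linked _≥_ L → init (topRow L) ≡ zipWith _+_ (tail (topRow L)) (gaps L)
topRow-chain []          _           = refl
topRow-chain (x ∷ [])    _           = refl
topRow-chain (x ∷ y ∷ L) (x≥y ∷ desc) = cong₂ _∷_ (sym (m+[n∸m]≡n x≥y)) (topRow-chain (y ∷ L) desc)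

matrixOf : (x : ℕ) (L : List ℕ) → Profile (x ∷ L) → Matrix
matrixOf x L (desc , pos) = mkMatrix (length (x ∷ L)) (topRow (x ∷ L)) (0 ∷ gaps (x ∷ L))
                                     (topRow-last (x ∷ L)) (gaps-last x L pos) (topRow-chain (x ∷ L) desc)

-- m > 0 rules out the empty profile, the only one without a matrix.
nonEmpty : ∀ {m} → 0 < m → m ≢ sum [] ^ 2 + 2 * sumsq []
nonEmpty m>0 m≡0 = <-irrefl (sym m≡0) m>0

fromProfile : ∀ {m} → 0 < m → ProfileFiber m → Fiber m
fromProfile m>0 ([]      , _ , m≡0) = ⊥-elim (nonEmpty m>0 m≡0)
fromProfile m>0 ((x ∷ L) , isProfile , m≡) =
  matrixOf x L isProfile , refl ,
  trans (P-formula (matrixOf x L isProfile) refl)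
        (trans (cong (λ z → sum z ^ 2 + 2 * sumsq z) (topRow-init (x ∷ L))) (sym m≡))

fiber-≡ : ∀ {m} (M M′ : Matrix) (p : In𝓜₀ M × P M ≡ m) (q : In𝓜₀ M′ × P M′ ≡ m) →
          M ≡ M′ → _≡_ {A = Fiber m} (M , p) (M′ , q)
fiber-≡ M .M (d₁≡0 , PM≡m) (d₁≡0′ , PM≡m′) refl with ≡-irrelevant d₁≡0 d₁≡0′ | ≡-irrelevant PM≡m PM≡m′
... | refl | refl = refl

gaps-profile : ∀ {t} (c : Vec ℕ (suc (suc t))) (e : Vec ℕ (suc t)) → Staircase (toList c) (toList e) →
               toList (gaps (toList (init c))) ≡ toList e
gaps-profile {zero}  (_ ∷ _ ∷ [])     (_ ∷ [])        (step bottom) = refl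
gaps-profile {suc t} (_ ∷ y ∷ z ∷ cs) (e₀ ∷ e₁ ∷ es) (step stairs) =
  cong₂ _∷_ (m+n∸m≡n y e₀) (gaps-profile (y ∷ z ∷ cs) (e₁ ∷ es) stairs)

fromProfile-toProfile : ∀ {m} (m>0 : 0 < m) (F : Fiber m) → fromProfile m>0 (toProfile F) ≡ F
fromProfile-toProfile m>0 (mkMatrix zero c (d₁ ∷ []) _ () _ , refl , _)
fromProfile-toProfile m>0 (M@(mkMatrix (suc t) c@(_ ∷ _ ∷ _) (d₁ ∷ e) c-last _ chain) , refl , _) =
  fiber-≡ _ M _ _ (matrix-≡ _ M same-top (cong (0 ∷_) (gaps-profile c e (staircase c e c-last chain))))
  where
  same-top : toList (topRow (profile M)) ≡ toList c
  same-top = trans (topRow-toList (profile M))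
                   (sym (trans (toList-init-last c) (cong (λ w → profile M ++ w ∷ []) c-last)))

toProfile-fromProfile : ∀ {m} (m>0 : 0 < m) (Q : ProfileFiber m) → toProfile (fromProfile m>0 Q) ≡ Q
toProfile-fromProfile m>0 ([]      , _ , m≡0) = ⊥-elim (nonEmpty m>0 m≡0)
toProfile-fromProfile m>0 ((x ∷ L) , _ , _)   = profileFiber-≡ _ _ (topRow-init (x ∷ L))

fiber↔profiles : ∀ {m} → 0 < m → Fiber m ↔ ProfileFiber m
fiber↔profiles m>0 = mk↔ₛ′ toProfile (fromProfile m>0) (toProfile-fromProfile m>0) (fromProfile-toProfile m>0)

pad : (n : ℕ) → List ℕ → Vec ℕ n
pad zero    _       = []
pad (suc n) []      = 0 ∷ pad n []
pad (suc n) (x ∷ L) = x ∷ pad n L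

stripZeros : List ℕ → List ℕ
stripZeros []           = []
stripZeros (zero  ∷ _)  = []
stripZeros (suc y ∷ xs) = suc y ∷ stripZeros xs

-- A profile has at most Σ L entries, so padding to length Σ L loses nothing.
length≤sum : ∀ L → All (0 <_) L → length L ≤ sum L
length≤sum []      _         = z≤n
length≤sum (x ∷ L) (x>0 ∷ pos) = +-mono-≤ x>0 (length≤sum L pos)

zeros-descend : ∀ n → Linked _≥_ (toList (pad n []))
zeros-descend zero          = []
zeros-descend (suc zero)    = [-]
zeros-descend (suc (suc n)) = z≤n ∷ zeros-descend (suc n)

pad-descends : ∀ n L → Linked _≥_ L → Linked _≥_ (toList (pad n L))
pad-descends zero          L           _            = []
pad-descends (suc n)       []          _            = zeros-descend (suc n)
pad-descends (suc zero)    (x ∷ L)     _            = [-]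
pad-descends (suc (suc n)) (x ∷ [])    _            = z≤n ∷ zeros-descend (suc n)
pad-descends (suc (suc n)) (x ∷ y ∷ L) (x≥y ∷ desc) = x≥y ∷ pad-descends (suc n) (y ∷ L) desc

sum-zeros : ∀ (f : ℕ → ℕ) → f 0 ≡ 0 → ∀ n → sum (map f (toList (pad n []))) ≡ 0
sum-zeros f f0≡0 zero    = refl
sum-zeros f f0≡0 (suc n) = cong₂ _+_ f0≡0 (sum-zeros f f0≡0 n)

sum-pad : ∀ (f : ℕ → ℕ) → f 0 ≡ 0 → ∀ n L → length L ≤ n → sum (map f (toList (pad n L))) ≡ sum (map f L)
sum-pad f f0≡0 n       []      _         = sum-zeros f f0≡0 n
sum-pad f f0≡0 (suc n) (x ∷ L) (s≤s L≤n) = cong (f x +_) (sum-pad f f0≡0 n L L≤n)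

sum-after-zero : ∀ (f : ℕ → ℕ) → f 0 ≡ 0 → ∀ ys → Linked _≥_ (0 ∷ ys) → sum (map f ys) ≡ 0
sum-after-zero f f0≡0 []       _              = refl
sum-after-zero f f0≡0 (y ∷ ys) (0≥y ∷ desc) with n≤0⇒n≡0 0≥y
... | refl = cong₂ _+_ f0≡0 (sum-after-zero f f0≡0 ys desc)

sum-stripZeros : ∀ (f : ℕ → ℕ) → f 0 ≡ 0 → ∀ xs → Linked _≥_ xs → sum (map f (stripZeros xs)) ≡ sum (map f xs)
sum-stripZeros f f0≡0 []           _    = refl
sum-stripZeros f f0≡0 (zero ∷ ys)  desc =
  sym (trans (cong (_+ sum (map f ys)) f0≡0) (sum-after-zero f f0≡0 ys desc))
sum-stripZeros f f0≡0 (suc y ∷ ys) desc = cong (f (suc y) +_) (sum-stripZeros f f0≡0 ys (Linked.tail desc))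

stripZeros-sum : ∀ xs → Linked _≥_ xs → sum (stripZeros xs) ≡ sum xs
stripZeros-sum xs desc = trans (sum-as-map (stripZeros xs))
                               (trans (sum-stripZeros (λ y → y) refl xs desc) (sym (sum-as-map xs)))

stripZeros-descends : ∀ xs → Linked _≥_ xs → Linked _≥_ (stripZeros xs)
stripZeros-descends []                   _            = []
stripZeros-descends (zero ∷ _)           _            = []
stripZeros-descends (suc y ∷ [])         _            = [-]
stripZeros-descends (suc y ∷ zero ∷ _)   _            = [-]
stripZeros-descends (suc y ∷ suc z ∷ zs) (y≥z ∷ desc) = y≥z ∷ stripZeros-descends (suc z ∷ zs) desc

stripZeros-positive : ∀ xs → All (0 <_) (stripZeros xs)
stripZeros-positive []           = []
stripZeros-positive (zero ∷ _)   = []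
stripZeros-positive (suc y ∷ xs) = s≤s z≤n ∷ stripZeros-positive xs

stripZeros-pad : ∀ n L → All (0 <_) L → length L ≤ n → stripZeros (toList (pad n L)) ≡ L
stripZeros-pad zero    []          _         _         = refl
stripZeros-pad (suc n) []          _         _         = refl
stripZeros-pad (suc n) (suc y ∷ L) (_ ∷ pos) (s≤s L≤n) = cong (suc y ∷_) (stripZeros-pad n L pos L≤n)

zeros-after-zero : ∀ {n} (x : Vec ℕ n) → Linked _≥_ (0 ∷ toList x) → toList (pad n []) ≡ toList x
zeros-after-zero []      _              = refl
zeros-after-zero (y ∷ x) (0≥y ∷ desc) with n≤0⇒n≡0 0≥y
... | refl = cong (0 ∷_) (zeros-after-zero x desc)

pad-stripZeros : ∀ {b} (x : Vec ℕ b) → Linked _≥_ (toList x) → toList (pad b (stripZeros (toList x))) ≡ toList x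
pad-stripZeros []          _    = refl
pad-stripZeros (zero ∷ x)  desc = cong (0 ∷_) (zeros-after-zero x desc)
pad-stripZeros (suc y ∷ x) desc = cong (suc y ∷_) (pad-stripZeros x (Linked.tail desc))

square-parity : ∀ x → (x ^ 2) % 2 ≡ x % 2
square-parity zero          = refl
square-parity (suc zero)    = refl
square-parity (suc (suc y)) = begin
  (suc (suc y) ^ 2) % 2         ≡⟨ cong (_% 2) (expand y) ⟩
  (y ^ 2 + (2 * y + 2) * 2) % 2 ≡⟨ [m+kn]%n≡m%n (y ^ 2) (2 * y + 2) 2 ⟩
  (y ^ 2) % 2                   ≡⟨ square-parity y ⟩
  y % 2                         ≡⟨ sym ([m+kn]%n≡m%n y 1 2) ⟩
  (y + 1 * 2) % 2               ≡⟨ cong (_% 2) (+-comm y 2) ⟩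
  suc (suc y) % 2               ∎
  where
  expand : ∀ y → suc (suc y) * (suc (suc y) * 1) ≡ y * (y * 1) + (2 * y + 2) * 2
  expand = solve-∀

sumsq-parity : ∀ L → sumsq L % 2 ≡ sum L % 2
sumsq-parity []      = refl
sumsq-parity (x ∷ L) = begin
  (x ^ 2 + sumsq L) % 2             ≡⟨ %-distribˡ-+ (x ^ 2) (sumsq L) 2 ⟩
  ((x ^ 2) % 2 + sumsq L % 2) % 2   ≡⟨ cong₂ (λ a b → (a + b) % 2) (square-parity x) (sumsq-parity L) ⟩
  (x % 2 + sum L % 2) % 2           ≡⟨ sym (%-distribˡ-+ x (sum L) 2) ⟩
  (x + sum L) % 2                   ∎

toSolution : ∀ {m} → ProfileFiber m → RHS m
toSolution (L , (desc , pos) , m≡) =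
  sumsq L , sum L , sumsq-parity L , m≡ ,
  pad (sum L) L , pad-descends (sum L) L desc ,
  trans (sum-as-map (toList (pad (sum L) L))) (trans (sum-pad (λ y → y) refl (sum L) L L≤b) (sym (sum-as-map L))) ,
  sum-pad sq refl (sum L) L L≤b
  where
  L≤b = length≤sum L pos

fromSolution : ∀ {m} → RHS m → ProfileFiber m
fromSolution (a , b , _ , m≡ , x , desc , Σx≡b , Σx²≡a) =
  stripZeros (toList x) , (stripZeros-descends (toList x) desc , stripZeros-positive (toList x)) ,
  trans m≡ (cong₂ (λ u v → u ^ 2 + 2 * v)
                  (sym (trans (stripZeros-sum (toList x) desc) Σx≡b))
                  (sym (trans (sum-stripZeros sq refl (toList x) desc) Σx²≡a)))

solution-≡ : ∀ {m a a′ b b′} → a ≡ a′ → b ≡ b′ → (x : Vec ℕ b) (x′ : Vec ℕ b′) → toList x ≡ toList x′ →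
             ∀ par m≡ sol par′ m≡′ sol′ →
             _≡_ {A = RHS m} (a , b , par , m≡ , x , sol) (a′ , b′ , par′ , m≡′ , x′ , sol′)
solution-≡ refl refl x x′ x≡x′ par m≡ (desc , s₁ , s₂) par′ m≡′ (desc′ , s₁′ , s₂′)
  with vec-≡ x x′ x≡x′
... | refl with ≡-irrelevant par par′ | ≡-irrelevant m≡ m≡′ | Linked.irrelevant ≤-irrelevant desc desc′
                | ≡-irrelevant s₁ s₁′ | ≡-irrelevant s₂ s₂′
... | refl | refl | refl | refl | refl = refl

toSolution-fromSolution : ∀ {m} (R : RHS m) → toSolution (fromSolution R) ≡ R
toSolution-fromSolution (a , b , _ , _ , x , desc , Σx≡b , Σx²≡a) =
  solution-≡ (trans (sum-stripZeros sq refl (toList x) desc) Σx²≡a) b≡ _ x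
             (trans (cong (λ n → toList (pad n (stripZeros (toList x)))) b≡) (pad-stripZeros x desc))
             _ _ _ _ _ _
  where
  b≡ = trans (stripZeros-sum (toList x) desc) Σx≡b

fromSolution-toSolution : ∀ {m} (Q : ProfileFiber m) → fromSolution (toSolution Q) ≡ Q
fromSolution-toSolution (L , (_ , pos) , _) = profileFiber-≡ _ _ (stripZeros-pad (sum L) L pos (length≤sum L pos))

profiles↔solutions : ∀ {m} → ProfileFiber m ↔ RHS m
profiles↔solutions = mk↔ₛ′ toSolution fromSolution toSolution-fromSolution fromSolution-toSolution

theorem4p4 : (m : ℕ) → 0 < m → InImP m → Fiber m ↔ RHS m
theorem4p4 m m>0 _ = ↔-trans (fiber↔profiles m>0) profiles↔solutions
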